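{- Let $p$ be an odd prime, $n\ge1$, $d\in(\mathbb{Z}/p^n\mathbb{Z})^\times$ an element of order $p^{n-1}$, and $r$ an integer with $0<r\le p^{n-1}$. Let the additive group $\mathbb{Z}/p^n\mathbb{Z}$ act on the set $\mathbb{Z}/p^n\mathbb{Z}$ by $i\cdot_r j=jd^{ir}$. If $m$ is an integer with $0<m\le n-1-v_p(r)$, then the number of distinct orbits of this action whose stabilizer is the subgroup $\langle p^m\rangle$ of $\mathbb{Z}/p^n\mathbb{Z}$ equals $p^{v_p(r)}(p-1)$.
   Context: $v_p$ denotes the $p$-adic valuation. -}

module Defs where

open import Data.Nat using (ℕ; zero; suc; _*_; _^_; _<_; _%_; _≟_)
open import Data.Bool using (Bool)
import Data.Bool as B
open import Data.Fin using (Fin; toℕ)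
open import Data.Vec using (Vec; tabulate)
open import Data.Vec.Properties using (≡-dec)
open import Data.List using (List; length; map; filter; deduplicate; allFin)
open import Data.Bool.ListAction using (any)
open import Data.Nat.Divisibility using (_∣_)
open import Data.Product using (_×_)
open import Relation.Nullary using (¬_; ⌊_⌋)
open import Relation.Binary.PropositionalEquality using (_≡_; _≢_)

-- reduction modulo N (N is always p^n ≥ 1 in our use; for N = 0 we leave a unchanged)
md : ℕ → ℕ → ℕ
md a zero    = a
md a (suc k) = a % suc k

IsValuation : ℕ → ℕ → ℕ → Set
IsValuation p r v = (p ^ v ∣ r) × ¬ (p ^ suc v ∣ r)

MulOrder : ℕ → ℕ → ℕ → Set
MulOrder N d k = (md (d ^ k) N ≡ md 1 N) × (∀ j → 0 < j → j < k → md (d ^ j) N ≢ md 1 N)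

-- the action i ·_r j = j d^{i r} of Z/N on Z/N (residues represented by 0..N-1)
act : (N d r i j : ℕ) → ℕ
act N d r i j = md (j * d ^ (i * r)) N

orbit : (N d r j : ℕ) → Vec Bool N
orbit N d r j = tabulate λ k → any (λ i → ⌊ act N d r (toℕ i) j ≟ toℕ k ⌋) (allFin N)

stab : (N d r j : ℕ) → Vec Bool N
stab N d r j = tabulate λ i → ⌊ act N d r (toℕ i) j ≟ j ⌋

gen : (N g : ℕ) → Vec Bool N
gen N g = tabulate λ i → any (λ k → ⌊ md (toℕ k * g) N ≟ toℕ i ⌋) (allFin N)

numOrbitsWithStab : (N d r : ℕ) → Vec Bool N → ℕ
numOrbitsWithStab N d r H =
  length (deduplicate (≡-dec B._≟_)
    (map (λ j → orbit N d r (toℕ j))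
      (filter (λ j → ≡-dec B._≟_ (stab N d r (toℕ j)) H) (allFin N))))

-- Write N = p^n and r = p^v w with p ∤ w. Fermat's little theorem and the order hypothesis
-- give d ≡ 1 (mod p), and lifting the exponent then shows that for s < n, d^e ≡ 1 (mod p^(s+1))
-- exactly when p^s ∣ e. Hence for j = p^a u with p ∤ u the stabiliser of j is ⟨p^(n-1-a-v)⟩, so
-- the orbits with stabiliser ⟨p^m⟩ are those of the j of valuation exactly k = n-1-v-m. Such an
-- orbit lies in the class of j modulo M = p^(k+v+1) and has p^m = N/M elements, so it is that
-- whole class. The orbits are therefore counted by the residues modulo M of valuation exactly k,
-- and there are p^(v+1) - p^v of them.

module Submission where

open import Level using (0ℓ)
open import Data.Nat
open import Data.Nat.Properties
open import Data.Nat.Divisibility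
open import Data.Nat.DivMod
open import Data.Nat.Primality
open import Data.Nat.Coprimality using (Coprime)
open import Data.Nat.Combinatorics using (_C_; nCn≡1; nCk≡n!/k![n-k]!; k![n∸k]!∣n!)
open import Data.Nat.Induction using (<-rec)
open import Data.Nat.Tactic.RingSolver using (solve-∀)
open import Data.Bool using (Bool; T)
import Data.Bool as Bool
open import Data.Bool.Properties using (T-≡; ⇔→≡)
open import Data.Bool.ListAction using (any)
open import Data.Fin as Fin using (Fin; toℕ; fromℕ; fromℕ<; inject₁; punchOut) renaming (zero to fzero; suc to fsuc)
open import Data.Fin.Properties using (any?; punchOut-injective; injective⇒≤; toℕ-fromℕ; toℕ-fromℕ<; toℕ-inject₁; toℕ<n; toℕ-injective)
open import Data.Vec using (Vec; tabulate; lookup)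
open import Data.Vec.Properties using (lookup∘tabulate; tabulate∘lookup; tabulate-cong; ≡-dec)
open import Data.Vec.Functional using (Vector; tail)
open import Data.List using (List; []; _∷_; [_]; _++_; length; map; filter; upTo; allFin; deduplicate)
open import Data.List.Properties using (upTo-∷ʳ; filter-++; filter-accept; filter-reject; length-++; length-map)
open import Data.List.Membership.Propositional using (_∈_; lose)
open import Data.List.Membership.Propositional.Properties using (∈-allFin; ∈-map⁺; ∈-map⁻; ∈-deduplicate⁺; ∈-deduplicate⁻; ∈-filter⁺; ∈-filter⁻; ∈-upTo⁺; ∈-upTo⁻)
open import Data.List.Membership.Propositional.Properties.WithK using (unique∧set⇒bag)
open import Data.List.Relation.Binary.BagAndSetEquality using (∼bag⇒↭)
open import Data.List.Relation.Binary.Permutation.Propositional.Properties using (↭-length)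
open import Data.List.Relation.Unary.All as All using (All; []; _∷_)
open import Data.List.Relation.Unary.AllPairs using ([]; _∷_)
open import Data.List.Relation.Unary.Any using (satisfied)
open import Data.List.Relation.Unary.Any.Properties using (any⁺; any⁻)
open import Data.List.Relation.Unary.Unique.Propositional using (Unique)
open import Data.List.Relation.Unary.Unique.Propositional.Properties using (upTo⁺; filter⁺)
import Data.List.Relation.Unary.Unique.DecPropositional.Properties as Unique
open import Data.Product using (∃; ∃₂; _×_; _,_; proj₁; proj₂)
open import Data.Sum using (_⊎_; inj₁; inj₂)
open import Data.Empty using (⊥-elim)
open import Function.Base using (_∘_; id)
open import Function.Bundles using (_⇔_; mk⇔; Equivalence)
open import Function.Construct.Composition using (_⇔-∘_)
open import Function.Construct.Symmetry using (⇔-sym)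
open import Function.Definitions using (Injective)
open import Relation.Nullary using (¬_; Dec; yes; no; ⌊_⌋; _×-dec_; ¬?)
open import Relation.Nullary.Decidable using (toWitness; fromWitness)
open import Relation.Unary using (Pred; Decidable)
open import Relation.Binary.Bundles using (Setoid)
open import Relation.Binary.Structures using (IsEquivalence)
open import Relation.Binary.Definitions using (DecidableEquality)
import Relation.Binary.Reasoning.Setoid as SetoidReasoning
open import Relation.Binary.PropositionalEquality hiding ([_])
import Algebra.Properties.CommutativeSemiring.Binomial as Binomial
import Algebra.Definitions.RawMonoid as RawMonoidDefinitions
import Algebra.Definitions.RawSemiring as RawSemiringDefinitions
open import Defs

md≡% : ∀ a q .{{_ : NonZero q}} → md a q ≡ a % q
md≡% a (suc q) = refl

%-/-injective : ∀ {q a b} .{{_ : NonZero q}} → a % q ≡ b % q → a / q ≡ b / q → a ≡ b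
%-/-injective {q} {a} {b} a%q≡b%q a/q≡b/q = trans (m≡m%n+[m/n]*n a q)
  (trans (cong₂ (λ s t → s + t * q) a%q≡b%q a/q≡b/q) (sym (m≡m%n+[m/n]*n b q)))

n∸[n∸v∸m]∸v≡m : ∀ {n} v m → v + m ≤ n → n ∸ (n ∸ v ∸ m) ∸ v ≡ m
n∸[n∸v∸m]∸v≡m {n} v m v+m≤n = begin
  n ∸ (n ∸ v ∸ m) ∸ v  ≡⟨ cong (λ z → n ∸ z ∸ v) (∸-+-assoc n v m) ⟩
  n ∸ (n ∸ (v + m)) ∸ v  ≡⟨ cong (_∸ v) (m∸[m∸n]≡n v+m≤n) ⟩
  v + m ∸ v            ≡⟨ m+n∸m≡n v m ⟩
  m                    ∎
  where open ≡-Reasoning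

n∸a∸v≡m⇒a≡n∸v∸m : ∀ {n a} v {m} → 0 < m → a ≤ n → n ∸ a ∸ v ≡ m → a ≡ n ∸ v ∸ m
n∸a∸v≡m⇒a≡n∸v∸m {n} {a} v {m} 0<m a≤n e = begin
  a                ≡⟨ m∸[m∸n]≡n a≤n ⟨
  n ∸ (n ∸ a)      ≡⟨ cong (n ∸_) n∸a≡v+m ⟩
  n ∸ (v + m)      ≡⟨ ∸-+-assoc n v m ⟨
  n ∸ v ∸ m        ∎
  where
  open ≡-Reasoning
  v≤n∸a : v ≤ n ∸ a
  v≤n∸a = <⇒≤ (m∸n≢0⇒n<m λ n∸a∸v≡0 → <⇒≢ 0<m (trans (sym n∸a∸v≡0) e))
  n∸a≡v+m : n ∸ a ≡ v + m
  n∸a≡v+m = trans (sym (m+[n∸m]≡n v≤n∸a)) (cong (v +_) e)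

∣∧<⇒≡0 : ∀ {q δ} → q ∣ δ → δ < q → δ ≡ 0
∣∧<⇒≡0 {δ = zero}  _   _   = refl
∣∧<⇒≡0 {δ = suc _} q∣δ δ<q = ⊥-elim (<⇒≱ δ<q (∣⇒≤ q∣δ))

-- Congruences

infix 4 _≡_mod[_]

-- Stated without subtraction or division, so that it makes sense for every modulus.
_≡_mod[_] : ℕ → ℕ → ℕ → Set
a ≡ b mod[ q ] = ∃₂ λ k l → a + k * q ≡ b + l * q

module _ {q : ℕ} where

  ≡-mod-reflexive : ∀ {a b} → a ≡ b → a ≡ b mod[ q ]
  ≡-mod-reflexive refl = 0 , 0 , refl

  ≡-mod-refl : ∀ {a} → a ≡ a mod[ q ]
  ≡-mod-refl = ≡-mod-reflexive refl

  ≡-mod-sym : ∀ {a b} → a ≡ b mod[ q ] → b ≡ a mod[ q ]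
  ≡-mod-sym (k , l , e) = l , k , sym e

  ≡-mod-trans : ∀ {a b c} → a ≡ b mod[ q ] → b ≡ c mod[ q ] → a ≡ c mod[ q ]
  ≡-mod-trans {a} {b} {c} (k , l , e) (k′ , l′ , e′) = k + k′ , l′ + l , (begin
    a + (k + k′) * q      ≡⟨ shift a k k′ q ⟩
    (a + k * q) + k′ * q  ≡⟨ cong (_+ k′ * q) e ⟩
    (b + l * q) + k′ * q  ≡⟨ swap b l k′ q ⟩
    (b + k′ * q) + l * q  ≡⟨ cong (_+ l * q) e′ ⟩
    (c + l′ * q) + l * q  ≡⟨ shift c l′ l q ⟨
    c + (l′ + l) * q      ∎)
    where
    open ≡-Reasoning
    shift : ∀ a k k′ q → a + (k + k′) * q ≡ (a + k * q) + k′ * q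
    shift = solve-∀
    swap : ∀ b l k′ q → (b + l * q) + k′ * q ≡ (b + k′ * q) + l * q
    swap = solve-∀

  ≡-mod-isEquivalence : IsEquivalence _≡_mod[ q ]
  ≡-mod-isEquivalence = record { refl = ≡-mod-refl ; sym = ≡-mod-sym ; trans = ≡-mod-trans }

  +-cong-mod : ∀ {a b c e} → a ≡ b mod[ q ] → c ≡ e mod[ q ] → a + c ≡ b + e mod[ q ]
  +-cong-mod {a} {b} {c} {e} (k , l , h) (k′ , l′ , h′) = k + k′ , l + l′ , (begin
    (a + c) + (k + k′) * q      ≡⟨ regroup a c k k′ q ⟩
    (a + k * q) + (c + k′ * q)  ≡⟨ cong₂ _+_ h h′ ⟩
    (b + l * q) + (e + l′ * q)  ≡⟨ regroup b e l l′ q ⟨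
    (b + e) + (l + l′) * q      ∎)
    where
    open ≡-Reasoning
    regroup : ∀ a c k k′ q → (a + c) + (k + k′) * q ≡ (a + k * q) + (c + k′ * q)
    regroup = solve-∀

  *-cong-mod : ∀ {a b c e} → a ≡ b mod[ q ] → c ≡ e mod[ q ] → a * c ≡ b * e mod[ q ]
  *-cong-mod {a} {b} {c} {e} (k , l , h) (k′ , l′ , h′) =
    k * c + a * k′ + k * k′ * q , l * e + b * l′ + l * l′ * q , (begin
    a * c + (k * c + a * k′ + k * k′ * q) * q  ≡⟨ expand a c k k′ q ⟩
    (a + k * q) * (c + k′ * q)                 ≡⟨ cong₂ _*_ h h′ ⟩
    (b + l * q) * (e + l′ * q)                 ≡⟨ expand b e l l′ q ⟨
    b * e + (l * e + b * l′ + l * l′ * q) * q  ∎)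
    where
    open ≡-Reasoning
    expand : ∀ a c k k′ q → a * c + (k * c + a * k′ + k * k′ * q) * q ≡ (a + k * q) * (c + k′ * q)
    expand = solve-∀

  ^-cong-mod : ∀ {a b} → a ≡ b mod[ q ] → ∀ e → a ^ e ≡ b ^ e mod[ q ]
  ^-cong-mod h zero    = ≡-mod-refl
  ^-cong-mod h (suc e) = *-cong-mod h (^-cong-mod h e)

  ∣⇒≡0-mod : ∀ {a} → q ∣ a → a ≡ 0 mod[ q ]
  ∣⇒≡0-mod (divides c refl) = 0 , c , +-identityʳ _

  ≡0-mod⇒∣ : ∀ {a} → a ≡ 0 mod[ q ] → q ∣ a
  ≡0-mod⇒∣ {a} (k , l , e) =
    ∣m+n∣m⇒∣n (subst (q ∣_) (trans (sym e) (+-comm a (k * q))) (n∣m*n l)) (n∣m*n k)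

  ≡-mod⇒∣∣-∣ : ∀ {a b} → a ≡ b mod[ q ] → q ∣ ∣ a - b ∣
  ≡-mod⇒∣∣-∣ {a} {b} (k , l , e) = subst (q ∣_) distance (n∣m*n ∣ l - k ∣)
    where
    open ≡-Reasoning
    distance : ∣ l - k ∣ * q ≡ ∣ a - b ∣
    distance = begin
      ∣ l - k ∣ * q                  ≡⟨ *-distribʳ-∣-∣ q l k ⟩
      ∣ l * q - k * q ∣              ≡⟨ ∣m+n-m+o∣≡∣n-o∣ b (l * q) (k * q) ⟨
      ∣ b + l * q - b + k * q ∣      ≡⟨ cong (λ z → ∣ z - b + k * q ∣) e ⟨
      ∣ a + k * q - b + k * q ∣      ≡⟨ cong₂ ∣_-_∣ (+-comm a (k * q)) (+-comm b (k * q)) ⟩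
      ∣ k * q + a - k * q + b ∣      ≡⟨ ∣m+n-m+o∣≡∣n-o∣ (k * q) a b ⟩
      ∣ a - b ∣                      ∎

  ∣∣-∣⇒≡-mod : ∀ {a b} → q ∣ ∣ a - b ∣ → a ≡ b mod[ q ]
  ∣∣-∣⇒≡-mod {a} {b} (divides c h) with ≤-total a b
  ... | inj₁ a≤b = c , 0 , (begin
    a + c * q        ≡⟨ cong (a +_) h ⟨
    a + ∣ a - b ∣    ≡⟨ cong (a +_) (m≤n⇒∣m-n∣≡n∸m a≤b) ⟩
    a + (b ∸ a)      ≡⟨ m+[n∸m]≡n a≤b ⟩
    b                ≡⟨ +-identityʳ b ⟨
    b + 0 * q        ∎)
    where open ≡-Reasoning
  ... | inj₂ b≤a = ≡-mod-sym (c , 0 , (begin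
    b + c * q        ≡⟨ cong (b +_) h ⟨
    b + ∣ a - b ∣    ≡⟨ cong (b +_) (m≤n⇒∣n-m∣≡n∸m b≤a) ⟩
    b + (a ∸ b)      ≡⟨ m+[n∸m]≡n b≤a ⟩
    a                ≡⟨ +-identityʳ a ⟨
    a + 0 * q        ∎))
    where open ≡-Reasoning

  module _ .{{_ : NonZero q}} where

    ≡-mod⇒%≡% : ∀ {a b} → a ≡ b mod[ q ] → a % q ≡ b % q
    ≡-mod⇒%≡% {a} {b} (k , l , e) = begin
      a % q              ≡⟨ [m+kn]%n≡m%n a k q ⟨
      (a + k * q) % q    ≡⟨ cong (_% q) e ⟩
      (b + l * q) % q    ≡⟨ [m+kn]%n≡m%n b l q ⟩
      b % q              ∎
      where open ≡-Reasoning

    %≡%⇒≡-mod : ∀ {a b} → a % q ≡ b % q → a ≡ b mod[ q ]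
    %≡%⇒≡-mod {a} {b} h = b / q , a / q , (begin
      a + b / q * q                      ≡⟨ cong (_+ b / q * q) (m≡m%n+[m/n]*n a q) ⟩
      a % q + a / q * q + b / q * q      ≡⟨ cong (λ z → z + a / q * q + b / q * q) h ⟩
      b % q + a / q * q + b / q * q      ≡⟨ swap (b % q) (a / q * q) (b / q * q) ⟩
      b % q + b / q * q + a / q * q      ≡⟨ cong (_+ a / q * q) (m≡m%n+[m/n]*n b q) ⟨
      b + a / q * q                      ∎)
      where
      open ≡-Reasoning
      swap : ∀ x y z → x + y + z ≡ x + z + y
      swap = solve-∀

    %-≡-mod : ∀ a → a % q ≡ a mod[ q ]
    %-≡-mod a = %≡%⇒≡-mod (m%n%n≡m%n a q)

≡-mod-setoid : ℕ → Setoid 0ℓ 0ℓ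
≡-mod-setoid q = record { isEquivalence = ≡-mod-isEquivalence {q} }

module ≡-mod-Reasoning (q : ℕ) = SetoidReasoning (≡-mod-setoid q)

≡-mod-∣ : ∀ {q q′ a b} → q′ ∣ q → a ≡ b mod[ q ] → a ≡ b mod[ q′ ]
≡-mod-∣ {a = a} {b} (divides c refl) (k , l , e) = k * c , l * c ,
  trans (cong (a +_) (*-assoc k c _)) (trans e (cong (b +_) (sym (*-assoc l c _))))

*-scale-mod : ∀ {q a b} c → a ≡ b mod[ q ] → c * a ≡ c * b mod[ c * q ]
*-scale-mod {q} {a} {b} c (k , l , e) = k , l , (begin
  c * a + k * (c * q)  ≡⟨ factor c a k q ⟩
  c * (a + k * q)      ≡⟨ cong (c *_) e ⟩
  c * (b + l * q)      ≡⟨ factor c b l q ⟨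
  c * b + l * (c * q)  ∎)
  where
  open ≡-Reasoning
  factor : ∀ c a k q → c * a + k * (c * q) ≡ c * (a + k * q)
  factor = solve-∀

*-cancel-scale-mod : ∀ {q a b} c .{{_ : NonZero c}} → c * a ≡ c * b mod[ c * q ] → a ≡ b mod[ q ]
*-cancel-scale-mod {q} {a} {b} c h =
  ∣∣-∣⇒≡-mod (*-cancelˡ-∣ c (subst (c * q ∣_) (sym (*-distribˡ-∣-∣ c a b)) (≡-mod⇒∣∣-∣ h)))

∣-resp-≡-mod : ∀ {q q′ a b} → q′ ∣ q → a ≡ b mod[ q ] → q′ ∣ a → q′ ∣ b
∣-resp-≡-mod {q} {q′} {a} {b} q′∣q (k , l , e) q′∣a = ∣m+n∣m⇒∣n
  (subst (q′ ∣_) (trans e (+-comm b (l * q))) (∣m∣n⇒∣m+n q′∣a (∣n⇒∣m*n k q′∣q)))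
  (∣n⇒∣m*n l q′∣q)

≡1-mod⇒^≡1-mod : ∀ {q x} → x ≡ 1 mod[ q ] → ∀ e → x ^ e ≡ 1 mod[ q ]
≡1-mod⇒^≡1-mod x≡1 e = ≡-mod-trans (^-cong-mod x≡1 e) (≡-mod-reflexive (^-zeroˡ e))

T-≟ : ∀ {x y : ℕ} → T ⌊ x ≟ y ⌋ ⇔ x ≡ y
T-≟ = mk⇔ toWitness fromWitness

T-any-allFin : ∀ {n} {P : Pred (Fin n) 0ℓ} (P? : Decidable P) →
               T (any (λ i → ⌊ P? i ⌋) (allFin n)) ⇔ ∃ P
T-any-allFin P? = mk⇔
  (λ h → let i , Pi = satisfied (any⁻ (λ i → ⌊ P? i ⌋) (allFin _) h) in i , toWitness Pi)
  (λ (i , Pi) → any⁺ (λ i → ⌊ P? i ⌋) (lose (∈-allFin i) (fromWitness Pi)))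

T-lookup-tabulate : ∀ {n} (f : Fin n → Bool) i → T (lookup (tabulate f) i) ⇔ T (f i)
T-lookup-tabulate f i rewrite lookup∘tabulate f i = mk⇔ id id

tabulate-⇔ : ∀ {n} {f g : Fin n → Bool} → (∀ i → T (f i) ⇔ T (g i)) → tabulate f ≡ tabulate g
tabulate-⇔ f⇔g = tabulate-cong λ i → ⇔→≡ (mk⇔
  (λ fi → Equivalence.to T-≡ (Equivalence.to (f⇔g i) (Equivalence.from T-≡ fi)))
  (λ gi → Equivalence.to T-≡ (Equivalence.from (f⇔g i) (Equivalence.from T-≡ gi))))

≡-by-T-lookup : ∀ {n} {u v : Vec Bool n} → (∀ i → T (lookup u i) ⇔ T (lookup v i)) → u ≡ v
≡-by-T-lookup {u = u} {v} u⇔v = trans (sym (tabulate∘lookup u)) (trans (tabulate-⇔ u⇔v) (tabulate∘lookup v))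

≡⇒T-lookup⇔ : ∀ {n} {u v : Vec Bool n} → u ≡ v → ∀ i → T (lookup u i) ⇔ T (lookup v i)
≡⇒T-lookup⇔ refl i = mk⇔ (λ x → x) (λ x → x)

injective⇒surjective : ∀ {n} (f : Fin n → Fin n) → Injective _≡_ _≡_ f → ∀ y → ∃ λ i → f i ≡ y
injective⇒surjective {zero}  f inj ()
injective⇒surjective {suc n} f inj y with any? (λ i → f i Fin.≟ y)
... | yes hit = hit
... | no miss = ⊥-elim (n≮n n (injective⇒≤ f′-injective))
  where
  f′ : Fin (suc n) → Fin n
  f′ i = punchOut {i = y} λ y≡fi → miss (i , sym y≡fi)
  f′-injective : Injective _≡_ _≡_ f′
  f′-injective {i} {j} e = inj (punchOut-injective {i = y} {f i} {f j} _ _ e)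

module _ {X : Set} {A B : Pred X 0ℓ} (A? : Decidable A) (B? : Decidable B) (B⊆A : ∀ {x} → B x → A x) where

  private
    A∖B? : Decidable (λ x → A x × ¬ B x)
    A∖B? x = A? x ×-dec ¬? (B? x)

  length-filter-∖ : ∀ xs → length (filter A∖B? xs) + length (filter B? xs)
                           ≡ length (filter A? xs)
  length-filter-∖ [] = refl
  length-filter-∖ (x ∷ xs) = by-cases (B? x) (A? x)
    where
    open ≡-Reasoning
    by-cases : Dec (B x) → Dec (A x) →
               length (filter A∖B? (x ∷ xs)) + length (filter B? (x ∷ xs)) ≡ length (filter A? (x ∷ xs))
    by-cases (yes b) _ = begin
      length (filter A∖B? (x ∷ xs)) + length (filter B? (x ∷ xs))
        ≡⟨ cong₂ (λ u w → length u + length w) (filter-reject A∖B? (λ (_ , ¬b) → ¬b b)) (filter-accept B? b) ⟩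
      length (filter A∖B? xs) + suc (length (filter B? xs))   ≡⟨ +-suc _ _ ⟩
      suc (length (filter A∖B? xs) + length (filter B? xs))   ≡⟨ cong suc (length-filter-∖ xs) ⟩
      suc (length (filter A? xs))                             ≡⟨ cong length (filter-accept A? (B⊆A b)) ⟨
      length (filter A? (x ∷ xs))                             ∎
    by-cases (no ¬b) (yes a) = begin
      length (filter A∖B? (x ∷ xs)) + length (filter B? (x ∷ xs))
        ≡⟨ cong₂ (λ u w → length u + length w) (filter-accept A∖B? (a , ¬b)) (filter-reject B? ¬b) ⟩
      suc (length (filter A∖B? xs) + length (filter B? xs))   ≡⟨ cong suc (length-filter-∖ xs) ⟩
      suc (length (filter A? xs))                             ≡⟨ cong length (filter-accept A? a) ⟨
      length (filter A? (x ∷ xs))                             ∎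
    by-cases (no ¬b) (no ¬a) = begin
      length (filter A∖B? (x ∷ xs)) + length (filter B? (x ∷ xs))
        ≡⟨ cong₂ (λ u w → length u + length w) (filter-reject A∖B? (λ (a , _) → ¬a a)) (filter-reject B? ¬b) ⟩
      length (filter A∖B? xs) + length (filter B? xs)         ≡⟨ length-filter-∖ xs ⟩
      length (filter A? xs)                                   ≡⟨ cong length (filter-reject A? ¬a) ⟨
      length (filter A? (x ∷ xs))                             ∎

count : ∀ {P : Pred ℕ 0ℓ} → Decidable P → ℕ → ℕ
count P? n = length (filter P? (upTo n))

module _ {P : Pred ℕ 0ℓ} (P? : Decidable P) where

  count-suc : ∀ n → count P? (suc n) ≡ count P? n + length (filter P? [ n ])
  count-suc n = begin
    length (filter P? (upTo (suc n)))             ≡⟨ cong (length ∘ filter P?) (upTo-∷ʳ n) ⟨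
    length (filter P? (upTo n ++ [ n ]))          ≡⟨ cong length (filter-++ P? (upTo n) [ n ]) ⟩
    length (filter P? (upTo n) ++ filter P? [ n ]) ≡⟨ length-++ (filter P? (upTo n)) ⟩
    count P? n + length (filter P? [ n ])         ∎
    where open ≡-Reasoning

  count-accept : ∀ {n} → P n → count P? (suc n) ≡ suc (count P? n)
  count-accept {n} Pn = trans (count-suc n)
    (trans (cong (λ l → count P? n + length l) (filter-accept P? Pn)) (+-comm _ 1))

  count-reject : ∀ {n} → ¬ P n → count P? (suc n) ≡ count P? n
  count-reject {n} ¬Pn = trans (count-suc n)
    (trans (cong (λ l → count P? n + length l) (filter-reject P? ¬Pn)) (+-identityʳ _))

count-after-multiple : ∀ q t j → j < q → count (q ∣?_) (t * q + suc j) ≡ suc (count (q ∣?_) (t * q))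
count-after-multiple q t zero    _     = trans (cong (count (q ∣?_)) (+-comm (t * q) 1)) (count-accept (q ∣?_) (n∣m*n t))
count-after-multiple q t (suc j) 1+j<q = begin
  count (q ∣?_) (t * q + suc (suc j))   ≡⟨ cong (count (q ∣?_)) (+-suc (t * q) (suc j)) ⟩
  count (q ∣?_) (suc (t * q + suc j))   ≡⟨ count-reject (q ∣?_) q∤ ⟩
  count (q ∣?_) (t * q + suc j)         ≡⟨ count-after-multiple q t j (<-trans (n<1+n j) 1+j<q) ⟩
  suc (count (q ∣?_) (t * q))           ∎
  where
  open ≡-Reasoning
  q∤ : ¬ q ∣ t * q + suc j
  q∤ h = <⇒≱ 1+j<q (∣⇒≤ (∣m+n∣m⇒∣n h (n∣m*n t)))

count-multiples : ∀ q .{{_ : NonZero q}} t → count (q ∣?_) (t * q) ≡ t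
count-multiples q       zero    = refl
count-multiples q@(suc q′) (suc t) = begin
  count (q ∣?_) (q + t * q)       ≡⟨ cong (count (q ∣?_)) (+-comm q (t * q)) ⟩
  count (q ∣?_) (t * q + suc q′)  ≡⟨ count-after-multiple q t q′ ≤-refl ⟩
  suc (count (q ∣?_) (t * q))     ≡⟨ cong suc (count-multiples q t) ⟩
  suc t                           ∎
  where open ≡-Reasoning

module _ {A B X : Set} {P : Pred X 0ℓ} (g : X → B)
         (g-injectiveOn : ∀ {y y′} → P y → P y′ → g y ≡ g y′ → y ≡ y′) where

  unique-map⁺ : ∀ {ys} → All P ys → Unique ys → Unique (map g ys)
  unique-map⁺ []         []           = []
  unique-map⁺ (Py ∷ Pys) (y∉ys ∷ ys!) = separated Pys y∉ys ∷ unique-map⁺ Pys ys!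
    where
    separated : ∀ {zs} → All P zs → All (_ ≢_) zs → All (g _ ≢_) (map g zs)
    separated []         []            = []
    separated (Pz ∷ Pzs) (y≢z ∷ y≢zs) = (λ gy≡gz → y≢z (g-injectiveOn Py Pz gy≡gz)) ∷ separated Pzs y≢zs

  length-deduplicate-map : (_≟_ : DecidableEquality B) (f : A → B) (xs : List A) {ys : List X} →
    Unique ys → All P ys →
    (∀ {x} → x ∈ xs → ∃ λ y → y ∈ ys × f x ≡ g y) →
    (∀ {y} → y ∈ ys → ∃ λ x → x ∈ xs × f x ≡ g y) →
    length (deduplicate _≟_ (map f xs)) ≡ length ys
  length-deduplicate-map _≟_ f xs {ys} ys! Pys xs⊆ys ys⊆xs = trans
    (↭-length (∼bag⇒↭ (unique∧set⇒bag (Unique.deduplicate-! _≟_ (map f xs)) (unique-map⁺ Pys ys!)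
      (mk⇔ to from))))
    (length-map g ys)
    where
    to : ∀ {b} → b ∈ deduplicate _≟_ (map f xs) → b ∈ map g ys
    to b∈ with ∈-map⁻ f (∈-deduplicate⁻ _≟_ (map f xs) b∈)
    ... | x , x∈xs , refl = let y , y∈ys , fx≡gy = xs⊆ys x∈xs in
      subst (_∈ map g ys) (sym fx≡gy) (∈-map⁺ g y∈ys)
    from : ∀ {b} → b ∈ map g ys → b ∈ deduplicate _≟_ (map f xs)
    from b∈ with ∈-map⁻ g b∈
    ... | y , y∈ys , refl = let x , x∈xs , fx≡gy = ys⊆xs y∈ys in
      ∈-deduplicate⁺ _≟_ (subst (_∈ map f xs) fx≡gy (∈-map⁺ f x∈xs))

module PrimePowers {p : ℕ} (p-prime : Prime p) where

  instance
    p-nonZero : NonZero p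
    p-nonZero = prime⇒nonZero p-prime

  1<p : 1 < p
  1<p = nonTrivial⇒n>1 p {{prime⇒nonTrivial p-prime}}

  p^-monoʳ-∣ : ∀ {a b} → a ≤ b → p ^ a ∣ p ^ b
  p^-monoʳ-∣ {a} {b} a≤b = divides (p ^ (b ∸ a))
    (trans (cong (p ^_) (sym (m∸n+n≡m a≤b))) (^-distribˡ-+-* p (b ∸ a) a))

  p^a∣p^b⇒a≤b : ∀ a b → p ^ a ∣ p ^ b → a ≤ b
  p^a∣p^b⇒a≤b a b h with a ≤? b
  ... | yes a≤b = a≤b
  ... | no a≰b = ⊥-elim (>⇒∤ {{m^n≢0 p b}} (^-monoʳ-< p 1<p (≰⇒> a≰b)) h)

  p^a∣p^v*x⇒p^[a∸v]∣x : ∀ a v {x} → p ^ a ∣ p ^ v * x → p ^ (a ∸ v) ∣ x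
  p^a∣p^v*x⇒p^[a∸v]∣x a v {x} h with a ≤? v
  ... | yes a≤v = subst (λ z → p ^ z ∣ x) (sym (m≤n⇒m∸n≡0 a≤v)) (1∣ x)
  ... | no a≰v = *-cancelˡ-∣ (p ^ v) {{m^n≢0 p v}} (subst (_∣ p ^ v * x) split h)
    where
    split : p ^ a ≡ p ^ v * p ^ (a ∸ v)
    split = trans (cong (p ^_) (sym (m+[n∸m]≡n (≰⇒≥ a≰v)))) (^-distribˡ-+-* p v (a ∸ v))

  p^[a∸v]∣x⇒p^a∣p^v*x : ∀ a v {x} → p ^ (a ∸ v) ∣ x → p ^ a ∣ p ^ v * x
  p^[a∸v]∣x⇒p^a∣p^v*x a v {x} h =
    ∣-trans (subst (p ^ a ∣_) (^-distribˡ-+-* p v (a ∸ v)) (p^-monoʳ-∣ (m≤n+m∸n a v)))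
            (*-monoʳ-∣ (p ^ v) h)

  p^a∣u*x⇒p^a∣x : ∀ {u x} → ¬ p ∣ u → ∀ a → p ^ a ∣ u * x → p ^ a ∣ x
  p^a∣u*x⇒p^a∣x {u} {x} p∤u zero    h = 1∣ x
  p^a∣u*x⇒p^a∣x {u} {x} p∤u (suc a) h with p^a∣u*x⇒p^a∣x p∤u a (∣-trans (n∣m*n p) h)
  ... | divides c refl = *-monoˡ-∣ (p ^ a) (p∣c (euclidsLemma u c p-prime p∣u*c))
    where
    p∣u*c : p ∣ u * c
    p∣u*c = *-cancelʳ-∣ (p ^ a) {{m^n≢0 p a}} (subst (p * p ^ a ∣_) (sym (*-assoc u c (p ^ a))) h)
    p∣c : p ∣ u ⊎ p ∣ c → p ∣ c
    p∣c (inj₁ p∣u) = ⊥-elim (p∤u p∣u)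
    p∣c (inj₂ p∣c) = p∣c

  *-cancelˡ-unit-mod : ∀ a {u x y} → ¬ p ∣ u → u * x ≡ u * y mod[ p ^ a ] → x ≡ y mod[ p ^ a ]
  *-cancelˡ-unit-mod a {u} {x} {y} p∤u h = ∣∣-∣⇒≡-mod
    (p^a∣u*x⇒p^a∣x p∤u a (subst (p ^ a ∣_) (sym (*-distribˡ-∣-∣ u x y)) (≡-mod⇒∣∣-∣ h)))

  p^a*u-cancel-mod : ∀ a b {u x y} → ¬ p ∣ u →
                     p ^ a * u * x ≡ p ^ a * u * y mod[ p ^ a * p ^ b ] → x ≡ y mod[ p ^ b ]
  p^a*u-cancel-mod a b {u} {x} {y} p∤u h = *-cancelˡ-unit-mod b p∤u (*-cancel-scale-mod (p ^ a) {{m^n≢0 p a}}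
    (subst₂ (λ s t → s ≡ t mod[ p ^ a * p ^ b ]) (*-assoc (p ^ a) u x) (*-assoc (p ^ a) u y) h))

  p^a*u-cong-mod : ∀ a b {u x y} → x ≡ y mod[ p ^ b ] → p ^ a * u * x ≡ p ^ a * u * y mod[ p ^ a * p ^ b ]
  p^a*u-cong-mod a b {u} {x} {y} h = subst₂ (λ s t → s ≡ t mod[ p ^ a * p ^ b ])
    (sym (*-assoc (p ^ a) u x)) (sym (*-assoc (p ^ a) u y)) (*-scale-mod (p ^ a) (*-cong-mod (≡-mod-refl {a = u}) h))

  valuation⇒unit : ∀ {j} a → IsValuation p j a → ∃ λ u → j ≡ p ^ a * u × ¬ p ∣ u
  valuation⇒unit {j} a (divides u refl , p^[1+a]∤j) =
    u , *-comm u (p ^ a) , λ p∣u → p^[1+a]∤j (*-monoˡ-∣ (p ^ a) p∣u)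

  unit⇒valuation : ∀ {j} a {u} → j ≡ p ^ a * u → ¬ p ∣ u → IsValuation p j a
  unit⇒valuation {j} a {u} refl p∤u =
    divides u (*-comm (p ^ a) u) ,
    λ h → p∤u (*-cancelʳ-∣ (p ^ a) {{m^n≢0 p a}} (subst (p * p ^ a ∣_) (*-comm (p ^ a) u) h))

  valuation-resp-≡-mod : ∀ {q x y} k → p ^ suc k ∣ q → x ≡ y mod[ q ] → IsValuation p x k → IsValuation p y k
  valuation-resp-≡-mod k p^[1+k]∣q x≡y (p^k∣x , p^[1+k]∤x) =
    ∣-resp-≡-mod (∣-trans (n∣m*n p) p^[1+k]∣q) x≡y p^k∣x ,
    λ p^[1+k]∣y → p^[1+k]∤x (∣-resp-≡-mod p^[1+k]∣q (≡-mod-sym x≡y) p^[1+k]∣y)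

  valuation-exists : ∀ j → 0 < j → ∃ (IsValuation p j)
  valuation-exists = <-rec _ go
    where
    go : ∀ j → (∀ {i} → i < j → 0 < i → ∃ (IsValuation p i)) → 0 < j → ∃ (IsValuation p j)
    go j rec 0<j with p ∣? j
    ... | no p∤j = 0 , unit⇒valuation 0 (sym (*-identityˡ j)) p∤j
    ... | yes (divides zero refl) = ⊥-elim (<-irrefl refl 0<j)
    ... | yes (divides c@(suc _) refl) with rec (m<m*n c p 1<p) z<s
    ... | a , val-c with valuation⇒unit a val-c
    ... | u , c≡p^a*u , p∤u =
      suc a , unit⇒valuation (suc a) (trans (cong (_* p) c≡p^a*u) (regroup (p ^ a) u p)) p∤u
      where
      regroup : ∀ x u p → x * u * p ≡ p * x * u
      regroup = solve-∀

-- Fermat's little theorem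

module ℕ-Binomial = Binomial +-*-commutativeSemiring
module ℕ-Sum = RawMonoidDefinitions +-0-rawMonoid
module ℕ-Exp = RawSemiringDefinitions +-*-rawSemiring

×≡* : ∀ n x → n ℕ-Sum.× x ≡ n * x
×≡* zero    x = refl
×≡* (suc n) x = cong (x +_) (×≡* n x)

^≡^ : ∀ x n → x ℕ-Exp.^ n ≡ x ^ n
^≡^ x zero    = refl
^≡^ x (suc n) = cong (x *_) (^≡^ x n)

sum≡last-mod : ∀ {q} m (f : Vector ℕ (suc m)) → (∀ i → q ∣ f (inject₁ i)) →
               ℕ-Sum.sum f ≡ f (fromℕ m) mod[ q ]
sum≡last-mod zero    f q∣f = ≡-mod-reflexive (+-identityʳ (f fzero))
sum≡last-mod (suc m) f q∣f =
  +-cong-mod (∣⇒≡0-mod (q∣f fzero)) (sum≡last-mod m (tail f) (λ i → q∣f (fsuc i)))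

n∣n! : ∀ {n} .{{_ : NonZero n}} → n ∣ n !
n∣n! {suc n} = ∣m⇒∣m*n (n !) ∣-refl

nCk*k![n∸k]!≡n! : ∀ {n k} → k ≤ n → (n C k) * (k ! * (n ∸ k) !) ≡ n !
nCk*k![n∸k]!≡n! {n} {k} k≤n = trans
  (cong (_* (k ! * (n ∸ k) !)) (nCk≡n!/k![n-k]! k≤n))
  (m/n*n≡m {{k !* (n ∸ k) !≢0}} (k![n∸k]!∣n! k≤n))

module _ {p : ℕ} (p-prime : Prime p) where

  p∤k! : ∀ {k} → k < p → ¬ p ∣ k !
  p∤k! {zero}  k<p h = ¬prime[1] (subst Prime (∣1⇒≡1 h) p-prime)
  p∤k! {suc k} k<p h with euclidsLemma (suc k) (k !) p-prime h
  ... | inj₁ p∣1+k = <⇒≱ k<p (∣⇒≤ p∣1+k)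
  ... | inj₂ p∣k!  = p∤k! (<-trans (n<1+n k) k<p) p∣k!

  p∣pCk : ∀ {k} → 0 < k → k < p → p ∣ p C k
  p∣pCk {k} 0<k k<p with euclidsLemma (p C k) (k ! * (p ∸ k) !) p-prime
    (subst (p ∣_) (sym (nCk*k![n∸k]!≡n! (<⇒≤ k<p))) (n∣n! {{prime⇒nonZero p-prime}}))
  ... | inj₁ p∣pCk = p∣pCk
  ... | inj₂ p∣k![p∸k]! with euclidsLemma (k !) ((p ∸ k) !) p-prime p∣k![p∸k]!
  ...   | inj₁ p∣k!     = ⊥-elim (p∤k! k<p p∣k!)
  ...   | inj₂ p∣[p∸k]! = ⊥-elim (p∤k! (∸-monoʳ-< 0<k (<⇒≤ k<p)) p∣[p∸k]!)

module _ {p : ℕ} (p-prime : Prime p) (x : ℕ) where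

  private
    term : Fin (suc p) → ℕ
    term = ℕ-Binomial.binomialTerm x 1 p

  term-first : term fzero ≡ 1
  term-first = trans (+-identityʳ _) (trans (+-identityʳ _) (trans (^≡^ 1 p) (^-zeroˡ p)))

  term-last : ∀ k → toℕ k ≡ p → term k ≡ x ^ p
  term-last k k≡p rewrite k≡p = begin
    (p C p) ℕ-Sum.× (x ℕ-Exp.^ p * 1 ℕ-Exp.^ (p ∸ p))
      ≡⟨ cong (ℕ-Sum._× (x ℕ-Exp.^ p * 1 ℕ-Exp.^ (p ∸ p))) (nCn≡1 p) ⟩
    x ℕ-Exp.^ p * 1 ℕ-Exp.^ (p ∸ p) + 0              ≡⟨ +-identityʳ _ ⟩
    x ℕ-Exp.^ p * 1 ℕ-Exp.^ (p ∸ p)                  ≡⟨ cong (λ z → x ℕ-Exp.^ p * 1 ℕ-Exp.^ z) (n∸n≡0 p) ⟩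
    x ℕ-Exp.^ p * 1                                  ≡⟨ *-identityʳ _ ⟩
    x ℕ-Exp.^ p                                      ≡⟨ ^≡^ x p ⟩
    x ^ p                                            ∎
    where open ≡-Reasoning

  p∣term : ∀ k → 0 < toℕ k → toℕ k < p → p ∣ term k
  p∣term k 0<k k<p = subst (p ∣_) (sym (×≡* (p C toℕ k) _)) (∣m⇒∣m*n _ (p∣pCk p-prime 0<k k<p))

freshman-mod : ∀ {p} → Prime p → ∀ x → (x + 1) ^ p ≡ x ^ p + 1 mod[ p ]
freshman-mod {suc p₁} p-prime x = begin
  (x + 1) ^ p                          ≡⟨ ^≡^ (x + 1) p ⟨
  (x + 1) ℕ-Exp.^ p                    ≡⟨ ℕ-Binomial.theorem p x 1 ⟩
  term fzero + ℕ-Sum.sum (tail term)   ≈⟨ +-cong-mod ≡-mod-refl (sum≡last-mod p₁ (tail term) middle) ⟩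
  term fzero + term (fromℕ p)
    ≡⟨ cong₂ _+_ (term-first p-prime x) (term-last p-prime x (fromℕ p) (toℕ-fromℕ p)) ⟩
  1 + x ^ p                            ≡⟨ +-comm 1 (x ^ p) ⟩
  x ^ p + 1                            ∎
  where
  p = suc p₁
  open ≡-mod-Reasoning p
  term = ℕ-Binomial.binomialTerm x 1 p
  middle : ∀ i → p ∣ term (fsuc (inject₁ i))
  middle i = p∣term p-prime x (fsuc (inject₁ i)) z<s
    (s≤s (subst (_< p₁) (sym (toℕ-inject₁ i)) (toℕ<n i)))

fermat-mod : ∀ {p} → Prime p → ∀ x → x ^ p ≡ x mod[ p ]
fermat-mod {suc _} p-prime zero    = ≡-mod-refl
fermat-mod {p} p-prime (suc x) = begin
  suc x ^ p      ≡⟨ cong (_^ p) (+-comm 1 x) ⟩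
  (x + 1) ^ p    ≈⟨ freshman-mod p-prime x ⟩
  x ^ p + 1      ≈⟨ +-cong-mod (fermat-mod p-prime x) ≡-mod-refl ⟩
  x + 1          ≡⟨ +-comm x 1 ⟩
  suc x          ∎
  where open ≡-mod-Reasoning p

-- Lifting the exponent and the order of d

geometricSum : ℕ → ℕ → ℕ
geometricSum x zero    = 0
geometricSum x (suc i) = x ^ i + geometricSum x i

x^n+geometricSum≡1+x*geometricSum : ∀ x n → x ^ n + geometricSum x n ≡ 1 + x * geometricSum x n
x^n+geometricSum≡1+x*geometricSum x zero    = cong suc (sym (*-zeroʳ x))
x^n+geometricSum≡1+x*geometricSum x (suc n) = begin
  x * x ^ n + (x ^ n + geometricSum x n)  ≡⟨ cong (x * x ^ n +_) (x^n+geometricSum≡1+x*geometricSum x n) ⟩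
  x * x ^ n + (1 + x * geometricSum x n)  ≡⟨ factor x (x ^ n) (geometricSum x n) ⟩
  1 + x * (x ^ n + geometricSum x n)      ∎
  where
  open ≡-Reasoning
  factor : ∀ x y z → x * y + (1 + x * z) ≡ 1 + x * (y + z)
  factor = solve-∀

geometricSum-cong-mod : ∀ {q x y} → x ≡ y mod[ q ] → ∀ n → geometricSum x n ≡ geometricSum y n mod[ q ]
geometricSum-cong-mod h zero    = ≡-mod-refl
geometricSum-cong-mod h (suc n) = +-cong-mod (^-cong-mod h n) (geometricSum-cong-mod h n)

geometricSum-1 : ∀ n → geometricSum 1 n ≡ n
geometricSum-1 zero    = refl
geometricSum-1 (suc n) = cong₂ _+_ (^-zeroˡ n) (geometricSum-1 n)

∣x^n-1∣≡∣x-1∣*geometricSum : ∀ x n → ∣ x ^ n - 1 ∣ ≡ ∣ x - 1 ∣ * geometricSum x n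
∣x^n-1∣≡∣x-1∣*geometricSum x n = begin
  ∣ x ^ n - 1 ∣              ≡⟨ ∣m+o-n+o∣ (x ^ n) 1 G ⟨
  ∣ x ^ n + G - 1 + G ∣      ≡⟨ cong (λ z → ∣ z - 1 + G ∣) (x^n+geometricSum≡1+x*geometricSum x n) ⟩
  ∣ 1 + x * G - 1 + G ∣      ≡⟨ ∣m+n-m+o∣≡∣n-o∣ 1 (x * G) G ⟩
  ∣ x * G - G ∣              ≡⟨ cong (λ z → ∣ x * G - z ∣) (*-identityˡ G) ⟨
  ∣ x * G - 1 * G ∣          ≡⟨ *-distribʳ-∣-∣ G x 1 ⟨
  ∣ x - 1 ∣ * G              ∎
  where
  open ≡-Reasoning
  G = geometricSum x n
  ∣m+o-n+o∣ : ∀ m n o → ∣ m + o - n + o ∣ ≡ ∣ m - n ∣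
  ∣m+o-n+o∣ m n o = trans (cong₂ ∣_-_∣ (+-comm m o) (+-comm n o)) (∣m+n-m+o∣≡∣n-o∣ o m n)

module _ (p : ℕ) where

  -- x^p - 1 = (x - 1)(1 + x + ⋯ + x^(p-1)), and the second factor is ≡ p ≡ 0 modulo p.
  ≡1-mod-lift : ∀ {s x} → x ≡ 1 mod[ p ^ suc s ] → x ^ p ≡ 1 mod[ p ^ suc (suc s) ]
  ≡1-mod-lift {s} {x} x≡1 = ∣∣-∣⇒≡-mod
    (subst (p ^ suc (suc s) ∣_) (sym (∣x^n-1∣≡∣x-1∣*geometricSum x p))
      (subst (_∣ ∣ x - 1 ∣ * geometricSum x p) (*-comm (p ^ suc s) p)
        (*-pres-∣ (≡-mod⇒∣∣-∣ x≡1) p∣geometricSum)))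
    where
    open ≡-mod-Reasoning p
    p∣geometricSum : p ∣ geometricSum x p
    p∣geometricSum = ≡0-mod⇒∣ (begin
      geometricSum x p  ≈⟨ geometricSum-cong-mod (≡-mod-∣ (m∣m*n (p ^ s)) x≡1) p ⟩
      geometricSum 1 p  ≡⟨ geometricSum-1 p ⟩
      p                 ≈⟨ ∣⇒≡0-mod ∣-refl ⟩
      0                 ∎)

  ≡1-mod-lift-iter : ∀ {s x} t → x ≡ 1 mod[ p ^ suc s ] → x ^ (p ^ t) ≡ 1 mod[ p ^ suc (t + s) ]
  ≡1-mod-lift-iter {s} {x} zero    x≡1 = ≡-mod-trans (≡-mod-reflexive (*-identityʳ x)) x≡1
  ≡1-mod-lift-iter {s} {x} (suc t) x≡1 = ≡-mod-trans
    (≡-mod-reflexive (trans (cong (x ^_) (*-comm p (p ^ t))) (sym (^-*-assoc x (p ^ t) p))))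
    (≡1-mod-lift {t + s} (≡1-mod-lift-iter {s} t x≡1))

fermat-iter-mod : ∀ {p} → Prime p → ∀ x t → x ^ (p ^ t) ≡ x mod[ p ]
fermat-iter-mod {p} p-prime x zero    = ≡-mod-reflexive (*-identityʳ x)
fermat-iter-mod {p} p-prime x (suc t) = begin
  x ^ (p * p ^ t)    ≡⟨ ^-*-assoc x p (p ^ t) ⟨
  (x ^ p) ^ (p ^ t)  ≈⟨ ^-cong-mod (fermat-mod p-prime x) (p ^ t) ⟩
  x ^ (p ^ t)        ≈⟨ fermat-iter-mod p-prime x t ⟩
  x                  ∎
  where open ≡-mod-Reasoning p

module OrderOfUnit {p} (p-prime : Prime p) (n₁ d : ℕ) (ord : MulOrder (p ^ suc n₁) d (p ^ n₁)) where

  open PrimePowers p-prime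

  private
    N = p ^ suc n₁
    P = p ^ n₁
    instance
      N-nonZero : NonZero N
      N-nonZero = m^n≢0 p (suc n₁)
      P-nonZero : NonZero P
      P-nonZero = m^n≢0 p n₁

  d^P≡1 : d ^ P ≡ 1 mod[ N ]
  d^P≡1 = %≡%⇒≡-mod (trans (sym (md≡% (d ^ P) N)) (trans (proj₁ ord) (md≡% 1 N)))

  d^j≢1 : ∀ {j} → 0 < j → j < P → ¬ d ^ j ≡ 1 mod[ N ]
  d^j≢1 {j} 0<j j<P h = proj₂ ord j 0<j j<P (trans (md≡% (d ^ j) N) (trans (≡-mod⇒%≡% h) (sym (md≡% 1 N))))

  d^e≡1⇒P∣e : ∀ {e} → d ^ e ≡ 1 mod[ N ] → P ∣ e
  d^e≡1⇒P∣e {e} d^e≡1 with e % P in e%P≡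
  ... | zero = m%n≡0⇒n∣m e P e%P≡
  ... | suc r = ⊥-elim (d^j≢1 z<s (subst (_< P) e%P≡ (m%n<n e P)) d^[1+r]≡1)
    where
    d^[1+r]≡1 : d ^ suc r ≡ 1 mod[ N ]
    d^[1+r]≡1 = begin
      d ^ suc r                          ≡⟨ *-identityʳ _ ⟨
      d ^ suc r * 1
        ≈⟨ *-cong-mod (≡-mod-refl {a = d ^ suc r}) (≡1-mod⇒^≡1-mod d^P≡1 (e / P)) ⟨
      d ^ suc r * (d ^ P) ^ (e / P)      ≡⟨ cong₂ (λ a b → d ^ a * b) e%P≡ (sym (^-*-assoc d P (e / P))) ⟨
      d ^ (e % P) * d ^ (P * (e / P))    ≡⟨ cong (λ z → d ^ (e % P) * d ^ z) (*-comm P (e / P)) ⟩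
      d ^ (e % P) * d ^ (e / P * P)      ≡⟨ ^-distribˡ-+-* d (e % P) (e / P * P) ⟨
      d ^ (e % P + e / P * P)            ≡⟨ cong (d ^_) (m≡m%n+[m/n]*n e P) ⟨
      d ^ e                              ≈⟨ d^e≡1 ⟩
      1                                  ∎
      where open ≡-mod-Reasoning N

  d≡1-mod-p : d ≡ 1 mod[ p ]
  d≡1-mod-p = ≡-mod-trans (≡-mod-sym (fermat-iter-mod p-prime d n₁)) (≡-mod-∣ (m∣m*n P) d^P≡1)

  p^s∣e⇒d^e≡1 : ∀ s {e} → p ^ s ∣ e → d ^ e ≡ 1 mod[ p ^ suc s ]
  p^s∣e⇒d^e≡1 s {e} (divides c refl) = begin
    d ^ (c * p ^ s)    ≡⟨ cong (d ^_) (*-comm c (p ^ s)) ⟩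
    d ^ (p ^ s * c)    ≡⟨ ^-*-assoc d (p ^ s) c ⟨
    (d ^ p ^ s) ^ c    ≈⟨ ≡1-mod⇒^≡1-mod (subst (λ z → d ^ p ^ s ≡ 1 mod[ p ^ suc z ]) (+-identityʳ s)
                            (≡1-mod-lift-iter p s (≡-mod-∣ (∣-reflexive (*-identityʳ p)) d≡1-mod-p))) c ⟩
    1                  ∎
    where open ≡-mod-Reasoning (p ^ suc s)

  d^e≡1⇒p^s∣e : ∀ {s e} → s ≤ n₁ → d ^ e ≡ 1 mod[ p ^ suc s ] → p ^ s ∣ e
  d^e≡1⇒p^s∣e {s} {e} s≤n₁ d^e≡1 = subst (λ z → p ^ z ∣ e) (m∸[m∸n]≡n s≤n₁)
    (p^a∣p^v*x⇒p^[a∸v]∣x n₁ (n₁ ∸ s) (d^e≡1⇒P∣e lifted))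
    where
    lifted : d ^ (p ^ (n₁ ∸ s) * e) ≡ 1 mod[ N ]
    lifted = subst₂ (λ a b → b ≡ 1 mod[ p ^ a ])
      (cong suc (m∸n+n≡m s≤n₁))
      (trans (^-*-assoc d e (p ^ (n₁ ∸ s))) (cong (d ^_) (*-comm e (p ^ (n₁ ∸ s)))))
      (≡1-mod-lift-iter p (n₁ ∸ s) d^e≡1)

-- The action of ℤ/N on ℤ/N

module Action {p} (p-prime : Prime p) (n₁ d r v : ℕ)
              (ord : MulOrder (p ^ suc n₁) d (p ^ n₁)) (r-val : IsValuation p r v) where

  open PrimePowers p-prime
  open OrderOfUnit p-prime n₁ d ord

  N : ℕ
  N = p ^ suc n₁

  instance
    N-nonZero : NonZero N
    N-nonZero = m^n≢0 p (suc n₁)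

  χ : ℕ → ℕ
  χ i = d ^ (i * r)

  act≡ : ∀ i j → act N d r i j ≡ j * χ i % N
  act≡ i j = md≡% (j * χ i) N

  private
    w : ℕ
    w = proj₁ (valuation⇒unit v r-val)

    p∤w : ¬ p ∣ w
    p∤w = proj₂ (proj₂ (valuation⇒unit v r-val))

    i*r≡p^v*[w*i] : ∀ i → i * r ≡ p ^ v * (w * i)
    i*r≡p^v*[w*i] i = trans (cong (i *_) (proj₁ (proj₂ (valuation⇒unit v r-val)))) (rearrange i (p ^ v) w)
      where
      rearrange : ∀ i x w → i * (x * w) ≡ x * (w * i)
      rearrange = solve-∀

  χ≡1⇒p^[s∸v]∣i : ∀ {s} i → s ≤ n₁ → χ i ≡ 1 mod[ p ^ suc s ] → p ^ (s ∸ v) ∣ i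
  χ≡1⇒p^[s∸v]∣i {s} i s≤n₁ χi≡1 = p^a∣u*x⇒p^a∣x p∤w (s ∸ v)
    (p^a∣p^v*x⇒p^[a∸v]∣x s v (subst (p ^ s ∣_) (i*r≡p^v*[w*i] i) (d^e≡1⇒p^s∣e s≤n₁ χi≡1)))

  p^[s∸v]∣i⇒χ≡1 : ∀ s i → p ^ (s ∸ v) ∣ i → χ i ≡ 1 mod[ p ^ suc s ]
  p^[s∸v]∣i⇒χ≡1 s i h = p^s∣e⇒d^e≡1 s
    (subst (p ^ s ∣_) (sym (i*r≡p^v*[w*i] i)) (p^[a∸v]∣x⇒p^a∣p^v*x s v (∣n⇒∣m*n w h)))

  N≡p^a*p^[1+n₁∸a] : ∀ {a} → a ≤ n₁ → N ≡ p ^ a * p ^ suc (n₁ ∸ a)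
  N≡p^a*p^[1+n₁∸a] {a} a≤n₁ = trans
    (cong (p ^_) (sym (trans (+-suc a (n₁ ∸ a)) (cong suc (m+[n∸m]≡n a≤n₁)))))
    (^-distribˡ-+-* p a (suc (n₁ ∸ a)))

  act≡j⇔ : ∀ i {j} → j < N → act N d r i j ≡ j ⇔ (j * χ i ≡ j mod[ N ])
  act≡j⇔ i {j} j<N = mk⇔
    (λ h → ≡-mod-trans (≡-mod-sym (%-≡-mod (j * χ i))) (≡-mod-reflexive (trans (sym (act≡ i j)) h)))
    (λ h → trans (act≡ i j) (trans (≡-mod⇒%≡% h) (m<n⇒m%n≡m j<N)))

  stabilises⇔ : ∀ {i j a u} → j < N → j ≡ p ^ a * u → ¬ p ∣ u → a ≤ n₁ →
                act N d r i j ≡ j ⇔ p ^ (n₁ ∸ a ∸ v) ∣ i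
  stabilises⇔ {i} {j} {a} {u} j<N refl p∤u a≤n₁ = mk⇔
    (χ≡1⇒p^[s∸v]∣i i (m∸n≤m n₁ a) ∘ p^a*u-cancel-mod a (suc (n₁ ∸ a)) p∤u ∘ in-factors ∘ Equivalence.to (act≡j⇔ i j<N))
    (Equivalence.from (act≡j⇔ i j<N) ∘ out-of-factors ∘ p^a*u-cong-mod a (suc (n₁ ∸ a)) ∘ p^[s∸v]∣i⇒χ≡1 (n₁ ∸ a) i)
    where
    in-factors : j * χ i ≡ j mod[ N ] → p ^ a * u * χ i ≡ p ^ a * u * 1 mod[ p ^ a * p ^ suc (n₁ ∸ a) ]
    in-factors = subst₂ (λ q t → j * χ i ≡ t mod[ q ]) (N≡p^a*p^[1+n₁∸a] a≤n₁) (sym (*-identityʳ j))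
    out-of-factors : p ^ a * u * χ i ≡ p ^ a * u * 1 mod[ p ^ a * p ^ suc (n₁ ∸ a) ] → j * χ i ≡ j mod[ N ]
    out-of-factors = subst₂ (λ q t → j * χ i ≡ t mod[ q ]) (sym (N≡p^a*p^[1+n₁∸a] a≤n₁)) (*-identityʳ j)

  stab-lookup : ∀ j i → T (lookup (stab N d r j) i) ⇔ act N d r (toℕ i) j ≡ j
  stab-lookup j i = T-≟ ⇔-∘ T-lookup-tabulate (λ i → ⌊ act N d r (toℕ i) j ≟ j ⌋) i

  gen-lookup : ∀ m → m ≤ suc n₁ → ∀ i → T (lookup (gen N (p ^ m)) i) ⇔ p ^ m ∣ toℕ i
  gen-lookup m m≤1+n₁ i =
    mk⇔ multiple⇒∣ ∣⇒multiple ⇔-∘ (T-any-allFin multiple? ⇔-∘ T-lookup-tabulate _ i)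
    where
    multiple? = λ (k : Fin N) → md (toℕ k * p ^ m) N ≟ toℕ i
    multiple⇒∣ : ∃ (λ (k : Fin N) → md (toℕ k * p ^ m) N ≡ toℕ i) → p ^ m ∣ toℕ i
    multiple⇒∣ (k , e) = subst (p ^ m ∣_) (trans (sym (md≡% (toℕ k * p ^ m) N)) e)
      (%-presˡ-∣ (n∣m*n (toℕ k)) (p^-monoʳ-∣ m≤1+n₁))
    ∣⇒multiple : p ^ m ∣ toℕ i → ∃ (λ (k : Fin N) → md (toℕ k * p ^ m) N ≡ toℕ i)
    ∣⇒multiple (divides c i≡c*p^m) = fromℕ< c<N , (begin
      md (toℕ (fromℕ< c<N) * p ^ m) N  ≡⟨ md≡% _ N ⟩
      toℕ (fromℕ< c<N) * p ^ m % N     ≡⟨ cong (λ z → z * p ^ m % N) (toℕ-fromℕ< c<N) ⟩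
      c * p ^ m % N                    ≡⟨ cong (_% N) i≡c*p^m ⟨
      toℕ i % N                        ≡⟨ m<n⇒m%n≡m (toℕ<n i) ⟩
      toℕ i                            ∎)
      where
      open ≡-Reasoning
      c<N : c < N
      c<N = ≤-<-trans (m≤m*n c (p ^ m) {{m^n≢0 p m}}) (subst (_< N) i≡c*p^m (toℕ<n i))

  valuation≤n₁ : ∀ {j} a → 0 < j → j < N → IsValuation p j a → a ≤ n₁
  valuation≤n₁ {j} a 0<j j<N (p^a∣j , _) with a ≤? n₁
  ... | yes a≤n₁ = a≤n₁
  ... | no a≰n₁ = ⊥-elim (<⇒≱ j<N (≤-trans (^-monoʳ-≤ p (≰⇒> a≰n₁)) (∣⇒≤ {{>-nonZero 0<j}} p^a∣j)))

  p^e∣⇒p^f∣⇒f≤e : ∀ {e f} → e ≤ n₁ → (∀ (i : Fin N) → p ^ e ∣ toℕ i → p ^ f ∣ toℕ i) → f ≤ e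
  p^e∣⇒p^f∣⇒f≤e {e} {f} e≤n₁ e⇒f = p^a∣p^b⇒a≤b f e
    (subst (p ^ f ∣_) (toℕ-fromℕ< p^e<N)
      (e⇒f (fromℕ< p^e<N) (subst (p ^ e ∣_) (sym (toℕ-fromℕ< p^e<N)) ∣-refl)))
    where
    p^e<N : p ^ e < N
    p^e<N = ^-monoʳ-< p 1<p (s≤s e≤n₁)

  χ-+ : ∀ i i′ → χ i * χ i′ ≡ χ (i + i′)
  χ-+ i i′ = trans (sym (^-distribˡ-+-* d (i * r) (i′ * r))) (cong (d ^_) (sym (*-distribʳ-+ r i i′)))

  χ≡χ[%N] : ∀ t → χ t ≡ χ (t % N) mod[ N ]
  χ≡χ[%N] t = begin
    χ t                              ≡⟨ cong χ (m≡m%n+[m/n]*n t N) ⟩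
    χ (t % N + t / N * N)            ≡⟨ χ-+ (t % N) (t / N * N) ⟨
    χ (t % N) * χ (t / N * N)        ≈⟨ *-cong-mod (≡-mod-refl {a = χ (t % N)}) χ[qN]≡1 ⟩
    χ (t % N) * 1                    ≡⟨ *-identityʳ _ ⟩
    χ (t % N)                        ∎
    where
    open ≡-mod-Reasoning N
    χ[qN]≡1 : χ (t / N * N) ≡ 1 mod[ N ]
    χ[qN]≡1 = p^[s∸v]∣i⇒χ≡1 n₁ (t / N * N)
      (∣n⇒∣m*n (t / N) (p^-monoʳ-∣ (≤-trans (m∸n≤m n₁ v) (n≤1+n n₁))))

  act-act : ∀ i i′ x → act N d r i′ (act N d r i x) ≡ act N d r ((i + i′) % N) x
  act-act i i′ x = trans (act≡ i′ (act N d r i x)) (trans (≡-mod⇒%≡% regrouped) (sym (act≡ ((i + i′) % N) x)))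
    where
    open ≡-mod-Reasoning N
    regrouped : act N d r i x * χ i′ ≡ x * χ ((i + i′) % N) mod[ N ]
    regrouped = begin
      act N d r i x * χ i′      ≡⟨ cong (_* χ i′) (act≡ i x) ⟩
      x * χ i % N * χ i′        ≈⟨ *-cong-mod (%-≡-mod (x * χ i)) (≡-mod-refl {a = χ i′}) ⟩
      x * χ i * χ i′            ≡⟨ trans (*-assoc x (χ i) (χ i′)) (cong (x *_) (χ-+ i i′)) ⟩
      x * χ (i + i′)            ≈⟨ *-cong-mod (≡-mod-refl {a = x}) (χ≡χ[%N] (i + i′)) ⟩
      x * χ ((i + i′) % N)      ∎

  act-zero : ∀ {x} → x < N → act N d r 0 x ≡ x
  act-zero {x} x<N = trans (act≡ 0 x) (trans (cong (_% N) (*-identityʳ x)) (m<n⇒m%n≡m x<N))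

  InOrbit : ℕ → ℕ → Set
  InOrbit x y = ∃ λ (i : Fin N) → act N d r (toℕ i) x ≡ y

  InOrbit-refl : ∀ {x} → x < N → InOrbit x x
  InOrbit-refl {x} x<N = fromℕ< 0<N , trans (cong (λ i → act N d r i x) (toℕ-fromℕ< 0<N)) (act-zero x<N)
    where
    0<N : 0 < N
    0<N = m^n>0 p (suc n₁)

  InOrbit-trans : ∀ {x y z} → InOrbit x y → InOrbit y z → InOrbit x z
  InOrbit-trans {x} {y} {z} (i , x→y) (i′ , y→z) = fromℕ< i+i′%N<N , (begin
    act N d r (toℕ (fromℕ< i+i′%N<N)) x             ≡⟨ cong (λ k → act N d r k x) (toℕ-fromℕ< i+i′%N<N) ⟩
    act N d r ((toℕ i + toℕ i′) % N) x              ≡⟨ act-act (toℕ i) (toℕ i′) x ⟨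
    act N d r (toℕ i′) (act N d r (toℕ i) x)        ≡⟨ cong (act N d r (toℕ i′)) x→y ⟩
    act N d r (toℕ i′) y                            ≡⟨ y→z ⟩
    z                                               ∎)
    where
    open ≡-Reasoning
    i+i′%N<N = m%n<n (toℕ i + toℕ i′) N

  orbit-lookup : ∀ x k → T (lookup (orbit N d r x) k) ⇔ InOrbit x (toℕ k)
  orbit-lookup x k = T-any-allFin (λ i → act N d r (toℕ i) x ≟ toℕ k) ⇔-∘ T-lookup-tabulate _ k

  orbit≡⇒InOrbit : ∀ {x y} → y < N → orbit N d r x ≡ orbit N d r y → InOrbit x y
  orbit≡⇒InOrbit {x} {y} y<N orbit≡ = subst (InOrbit x) (toℕ-fromℕ< y<N)
    (Equivalence.to (orbit-lookup x k) (Equivalence.from (≡⇒T-lookup⇔ orbit≡ k)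
      (Equivalence.from (orbit-lookup y k) (subst (InOrbit y) (sym (toℕ-fromℕ< y<N)) (InOrbit-refl y<N)))))
    where
    k = fromℕ< y<N

  InOrbit⇒orbit≡ : ∀ {x y} → InOrbit x y → InOrbit y x → orbit N d r x ≡ orbit N d r y
  InOrbit⇒orbit≡ {x} {y} x→y y→x = ≡-by-T-lookup λ k →
    ⇔-sym (orbit-lookup y k)
      ⇔-∘ (mk⇔ (InOrbit-trans {y} {x} y→x) (InOrbit-trans {x} {y} x→y) ⇔-∘ orbit-lookup x k)

  module Stabiliser (m : ℕ) (0<m : 0 < m) (m≤n₁∸v : m ≤ n₁ ∸ v) where

    k₀ : ℕ
    k₀ = n₁ ∸ v ∸ m

    ValK₀ : ℕ → Set
    ValK₀ j = IsValuation p j k₀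

    m≤n₁ : m ≤ n₁
    m≤n₁ = ≤-trans m≤n₁∸v (m∸n≤m n₁ v)

    v+m≤n₁ : v + m ≤ n₁
    v+m≤n₁ = subst (v + m ≤_) (m+[n∸m]≡n v≤n₁) (+-monoʳ-≤ v m≤n₁∸v)
      where
      v≤n₁ : v ≤ n₁
      v≤n₁ = <⇒≤ (m∸n≢0⇒n<m λ n₁∸v≡0 → <⇒≱ 0<m (subst (m ≤_) n₁∸v≡0 m≤n₁∸v))

    k₀≤n₁ : k₀ ≤ n₁
    k₀≤n₁ = ≤-trans (m∸n≤m (n₁ ∸ v) m) (m∸n≤m n₁ v)

    stabilises⇔p^m∣ : ∀ {i j} → j < N → ValK₀ j → act N d r i j ≡ j ⇔ p ^ m ∣ i
    stabilises⇔p^m∣ {i} {j} j<N val =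
      subst (λ e → act N d r i j ≡ j ⇔ p ^ e ∣ i) (n∸[n∸v∸m]∸v≡m v m v+m≤n₁)
      (stabilises⇔ j<N j≡p^k₀*u p∤u k₀≤n₁)
      where
      u = proj₁ (valuation⇒unit k₀ val)
      j≡p^k₀*u = proj₁ (proj₂ (valuation⇒unit k₀ val))
      p∤u = proj₂ (proj₂ (valuation⇒unit k₀ val))

    valK₀⇒stab≡gen : ∀ (j : Fin N) → ValK₀ (toℕ j) → stab N d r (toℕ j) ≡ gen N (p ^ m)
    valK₀⇒stab≡gen j val = ≡-by-T-lookup λ i →
      ⇔-sym (gen-lookup m (m≤n⇒m≤1+n m≤n₁) i)
        ⇔-∘ (stabilises⇔p^m∣ (toℕ<n j) val ⇔-∘ stab-lookup (toℕ j) i)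

    stabiliser⇒valK₀ : ∀ {j} → j < N →
                       (∀ (i : Fin N) → act N d r (toℕ i) j ≡ j ⇔ p ^ m ∣ toℕ i) → ValK₀ j
    stabiliser⇒valK₀ {zero} j<N stab⇔ = ⊥-elim (<⇒≱ (^-monoʳ-< p 1<p 0<m) (∣⇒≤ p^m∣1))
      where
      1<N : 1 < N
      1<N = ^-monoʳ-< p 1<p {0} {suc n₁} z<s
      p^m∣1 : p ^ m ∣ 1
      p^m∣1 = subst (p ^ m ∣_) (toℕ-fromℕ< 1<N) (Equivalence.to (stab⇔ (fromℕ< 1<N))
        (trans (act≡ (toℕ (fromℕ< 1<N)) 0) (m<n⇒m%n≡m (<-trans z<s 1<N))))
    stabiliser⇒valK₀ {j@(suc _)} j<N stab⇔ with valuation-exists j z<s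
    ... | a , val = subst (IsValuation p j) a≡k₀ val
      where
      a≤n₁ = valuation≤n₁ a z<s j<N val
      e = n₁ ∸ a ∸ v
      stab⇔p^e∣ : ∀ (i : Fin N) → act N d r (toℕ i) j ≡ j ⇔ p ^ e ∣ toℕ i
      stab⇔p^e∣ i = let u , j≡p^a*u , p∤u = valuation⇒unit a val in stabilises⇔ j<N j≡p^a*u p∤u a≤n₁
      m≤e : m ≤ e
      m≤e = p^e∣⇒p^f∣⇒f≤e (≤-trans (m∸n≤m (n₁ ∸ a) v) (m∸n≤m n₁ a))
        (λ i → Equivalence.to (stab⇔ i) ∘ Equivalence.from (stab⇔p^e∣ i))
      e≤m : e ≤ m
      e≤m = p^e∣⇒p^f∣⇒f≤e m≤n₁ (λ i → Equivalence.to (stab⇔p^e∣ i) ∘ Equivalence.from (stab⇔ i))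
      a≡k₀ : a ≡ k₀
      a≡k₀ = n∸a∸v≡m⇒a≡n∸v∸m v 0<m a≤n₁ (≤-antisym e≤m m≤e)

    stab≡gen⇒valK₀ : ∀ (j : Fin N) → stab N d r (toℕ j) ≡ gen N (p ^ m) → ValK₀ (toℕ j)
    stab≡gen⇒valK₀ j stab≡gen = stabiliser⇒valK₀ (toℕ<n j) λ i →
      gen-lookup m (m≤n⇒m≤1+n m≤n₁) i ⇔-∘ (≡⇒T-lookup⇔ stab≡gen i ⇔-∘ ⇔-sym (stab-lookup (toℕ j) i))

    M : ℕ
    M = p ^ (k₀ + suc v)

    instance
      M-nonZero : NonZero M
      M-nonZero = m^n≢0 p (k₀ + suc v)

    N≡p^m*M : N ≡ p ^ m * M
    N≡p^m*M = trans (cong (p ^_) exponents) (^-distribˡ-+-* p m (k₀ + suc v))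
      where
      k₀+[v+m]≡n₁ : k₀ + (v + m) ≡ n₁
      k₀+[v+m]≡n₁ = trans (cong (_+ (v + m)) (∸-+-assoc n₁ v m)) (m∸n+n≡m v+m≤n₁)
      regroup : ∀ k m v → suc (k + (v + m)) ≡ m + (k + suc v)
      regroup = solve-∀
      exponents : suc n₁ ≡ m + (k₀ + suc v)
      exponents = trans (cong suc (sym k₀+[v+m]≡n₁)) (regroup k₀ m v)

    M∣N : M ∣ N
    M∣N = divides (p ^ m) N≡p^m*M

    act-≡-mod-M : ∀ {x} → ValK₀ x → ∀ i → act N d r i x ≡ x mod[ M ]
    act-≡-mod-M {x} val i = ≡-mod-trans (≡-mod-∣ M∣N act≡x*χi) x*χi≡x
      where
      act≡x*χi : act N d r i x ≡ x * χ i mod[ N ]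
      act≡x*χi = ≡-mod-trans (≡-mod-reflexive (act≡ i x)) (%-≡-mod (x * χ i))
      χi≡1 : χ i ≡ 1 mod[ p ^ suc v ]
      χi≡1 = p^[s∸v]∣i⇒χ≡1 v i (subst (λ e → p ^ e ∣ i) (sym (n∸n≡0 v)) (1∣ i))
      x*χi≡x : x * χ i ≡ x mod[ M ]
      x*χi≡x with valuation⇒unit k₀ val
      ... | u , refl , _ = subst₂ (λ q t → p ^ k₀ * u * χ i ≡ t mod[ q ])
        (sym (^-distribˡ-+-* p k₀ (suc v))) (*-identityʳ _) (p^a*u-cong-mod k₀ (suc v) χi≡1)

    valK₀-resp-≡-mod-M : ∀ {x y} → ValK₀ x → x ≡ y mod[ M ] → ValK₀ y
    valK₀-resp-≡-mod-M val x≡y = valuation-resp-≡-mod k₀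
      (p^-monoʳ-∣ (subst (suc k₀ ≤_) (sym (+-suc k₀ v)) (s≤s (m≤m+n k₀ v)))) x≡y val

    act<N : ∀ i x → act N d r i x < N
    act<N i x = subst (_< N) (sym (act≡ i x)) (m%n<n (x * χ i) N)

    p^m≤N : p ^ m ≤ N
    p^m≤N = ^-monoʳ-≤ p (m≤n⇒m≤1+n m≤n₁)

    -- t ∸ s stabilises s · x, which again has valuation k₀.
    act-injective-≤ : ∀ {x s t} → ValK₀ x → s ≤ t → t < p ^ m → act N d r s x ≡ act N d r t x → s ≡ t
    act-injective-≤ {x} {s} {t} val s≤t t<p^m s·x≡t·x = begin
      s            ≡⟨ +-identityʳ s ⟨
      s + 0        ≡⟨ cong (s +_) δ≡0 ⟨
      s + (t ∸ s)  ≡⟨ m+[n∸m]≡n s≤t ⟩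
      t            ∎
      where
      open ≡-Reasoning
      y = act N d r s x
      δ·y≡y : act N d r (t ∸ s) y ≡ y
      δ·y≡y = trans (act-act s (t ∸ s) x) (trans (cong (λ k → act N d r (k % N) x) (m+[n∸m]≡n s≤t))
        (trans (cong (λ k → act N d r k x) (m<n⇒m%n≡m (<-≤-trans t<p^m p^m≤N))) (sym s·x≡t·x)))
      val-y : ValK₀ y
      val-y = valK₀-resp-≡-mod-M val (≡-mod-sym (act-≡-mod-M val s))
      δ≡0 : t ∸ s ≡ 0
      δ≡0 = ∣∧<⇒≡0 (Equivalence.to (stabilises⇔p^m∣ (act<N s x) val-y) δ·y≡y)
                   (≤-<-trans (m∸n≤m t s) t<p^m)

    act-injective : ∀ {x s t} → ValK₀ x → s < p ^ m → t < p ^ m → act N d r s x ≡ act N d r t x → s ≡ t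
    act-injective {s = s} {t} val s<p^m t<p^m s·x≡t·x with ≤-total s t
    ... | inj₁ s≤t = act-injective-≤ val s≤t t<p^m s·x≡t·x
    ... | inj₂ t≤s = sym (act-injective-≤ val t≤s s<p^m (sym s·x≡t·x))

    -- The p^m points i · x with i < p^m are distinct and all ≡ x modulo M, while below N = p^m M
    -- the class of x has exactly p^m elements, told apart by their quotients by M.
    InOrbit-complete : ∀ {x y} → ValK₀ x → y < N → x ≡ y mod[ M ] → InOrbit x y
    InOrbit-complete {x} {y} val y<N x≡y =
      fromℕ< i<N , trans (cong (λ k → act N d r k x) (toℕ-fromℕ< i<N)) i·x≡y
      where
      instance
        p^m-nonZero : NonZero (p ^ m)
        p^m-nonZero = m^n≢0 p m
      /M<p^m : ∀ {z} → z < N → z / M < p ^ m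
      /M<p^m {z} z<N = m<n*o⇒m/o<n (subst (z <_) N≡p^m*M z<N)
      level : Fin (p ^ m) → Fin (p ^ m)
      level i = fromℕ< (/M<p^m (act<N (toℕ i) x))
      residue : ∀ i → act N d r i x % M ≡ y % M
      residue i = ≡-mod⇒%≡% (≡-mod-trans (act-≡-mod-M val i) x≡y)
      toℕ-level : ∀ i → toℕ (level i) ≡ act N d r (toℕ i) x / M
      toℕ-level i = toℕ-fromℕ< (/M<p^m (act<N (toℕ i) x))
      level-injective : ∀ {i i′} → level i ≡ level i′ → i ≡ i′
      level-injective {i} {i′} e = toℕ-injective (act-injective val (toℕ<n i) (toℕ<n i′)
        (%-/-injective (trans (residue (toℕ i)) (sym (residue (toℕ i′))))
          (trans (sym (toℕ-level i)) (trans (cong toℕ e) (toℕ-level i′)))))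
      hit = injective⇒surjective level level-injective (fromℕ< (/M<p^m y<N))
      i = proj₁ hit
      i<N : toℕ i < N
      i<N = <-≤-trans (toℕ<n i) p^m≤N
      i·x≡y : act N d r (toℕ i) x ≡ y
      i·x≡y = %-/-injective (residue (toℕ i))
        (trans (sym (toℕ-level i)) (trans (cong toℕ (proj₂ hit)) (toℕ-fromℕ< (/M<p^m y<N))))

    orbit≡⇒≡-mod-M : ∀ {x y} → ValK₀ x → y < N → orbit N d r x ≡ orbit N d r y → x ≡ y mod[ M ]
    orbit≡⇒≡-mod-M {x} {y} val y<N orbit≡ with orbit≡⇒InOrbit {x} y<N orbit≡
    ... | i , i·x≡y = ≡-mod-trans (≡-mod-sym (act-≡-mod-M val (toℕ i))) (≡-mod-reflexive i·x≡y)

    ≡-mod-M⇒orbit≡ : ∀ {x y} → ValK₀ x → ValK₀ y → x < N → y < N →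
                     x ≡ y mod[ M ] → orbit N d r x ≡ orbit N d r y
    ≡-mod-M⇒orbit≡ val-x val-y x<N y<N x≡y =
      InOrbit⇒orbit≡ (InOrbit-complete val-x y<N x≡y) (InOrbit-complete val-y x<N (≡-mod-sym x≡y))

    valK₀? : Decidable ValK₀
    valK₀? j = p ^ k₀ ∣? j ×-dec ¬? (p ^ suc k₀ ∣? j)

    count-valK₀ : count valK₀? M ≡ p ^ v * (p ∸ 1)
    count-valK₀ = begin
      count valK₀? M                                ≡⟨ m+n∸n≡m (count valK₀? M) (count (p ^ suc k₀ ∣?_) M) ⟨
      count valK₀? M + count (p ^ suc k₀ ∣?_) M ∸ count (p ^ suc k₀ ∣?_) M
        ≡⟨ cong₂ _∸_ (length-filter-∖ (p ^ k₀ ∣?_) (p ^ suc k₀ ∣?_) (∣-trans (n∣m*n p)) (upTo M))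
                     count-p^[1+k₀] ⟩
      count (p ^ k₀ ∣?_) M ∸ p ^ v                 ≡⟨ cong₂ _∸_ count-p^k₀ (sym (*-identityˡ (p ^ v))) ⟩
      p * p ^ v ∸ 1 * p ^ v                        ≡⟨ *-distribʳ-∸ (p ^ v) p 1 ⟨
      (p ∸ 1) * p ^ v                              ≡⟨ *-comm (p ∸ 1) (p ^ v) ⟩
      p ^ v * (p ∸ 1)                              ∎
      where
      open ≡-Reasoning
      count-p^k₀ : count (p ^ k₀ ∣?_) M ≡ p ^ suc v
      count-p^k₀ = trans (cong (count (p ^ k₀ ∣?_)) (trans (^-distribˡ-+-* p k₀ (suc v)) (*-comm (p ^ k₀) _)))
        (count-multiples (p ^ k₀) {{m^n≢0 p k₀}} (p ^ suc v))
      count-p^[1+k₀] : count (p ^ suc k₀ ∣?_) M ≡ p ^ v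
      count-p^[1+k₀] = trans (cong (count (p ^ suc k₀ ∣?_)) (trans (cong (p ^_) (+-suc k₀ v))
          (trans (^-distribˡ-+-* p (suc k₀) v) (*-comm (p ^ suc k₀) _))))
        (count-multiples (p ^ suc k₀) {{m^n≢0 p (suc k₀)}} (p ^ v))

    <M⇒<N : ∀ {ρ} → ρ < M → ρ < N
    <M⇒<N ρ<M = <-≤-trans ρ<M (∣⇒≤ M∣N)

    stabilisers : List (Fin N)
    stabilisers = filter (λ j → ≡-dec Bool._≟_ (stab N d r (toℕ j)) (gen N (p ^ m))) (allFin N)

    residues : List ℕ
    residues = filter valK₀? (upTo M)

    ValK₀Residue : ℕ → Set
    ValK₀Residue ρ = ρ < M × ValK₀ ρ

    valK₀-residue : ∀ {ρ} → ρ ∈ residues → ValK₀Residue ρ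
    valK₀-residue ρ∈ = let ρ∈upTo , val = ∈-filter⁻ valK₀? {xs = upTo M} ρ∈ in ∈-upTo⁻ ρ∈upTo , val

    residue-injective : ∀ {ρ ρ′} → ValK₀Residue ρ → ValK₀Residue ρ′ →
                        orbit N d r ρ ≡ orbit N d r ρ′ → ρ ≡ ρ′
    residue-injective (ρ<M , val) (ρ′<M , _) orbit≡ = trans (sym (m<n⇒m%n≡m ρ<M))
      (trans (≡-mod⇒%≡% (orbit≡⇒≡-mod-M val (<M⇒<N ρ′<M) orbit≡)) (m<n⇒m%n≡m ρ′<M))

    stabiliser→residue : ∀ {j} → j ∈ stabilisers →
                         ∃ λ ρ → ρ ∈ residues × orbit N d r (toℕ j) ≡ orbit N d r ρ
    stabiliser→residue {j} j∈ = toℕ j % M , ∈-filter⁺ valK₀? (∈-upTo⁺ (m%n<n (toℕ j) M)) val-ρ ,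
      ≡-mod-M⇒orbit≡ val val-ρ (toℕ<n j) (<M⇒<N (m%n<n (toℕ j) M)) (≡-mod-sym (%-≡-mod (toℕ j)))
      where
      val : ValK₀ (toℕ j)
      val = stab≡gen⇒valK₀ j (proj₂ (∈-filter⁻ _ {xs = allFin N} j∈))
      val-ρ : ValK₀ (toℕ j % M)
      val-ρ = valK₀-resp-≡-mod-M val (≡-mod-sym (%-≡-mod (toℕ j)))

    residue→stabiliser : ∀ {ρ} → ρ ∈ residues →
                         ∃ λ j → j ∈ stabilisers × orbit N d r (toℕ j) ≡ orbit N d r ρ
    residue→stabiliser {ρ} ρ∈ with valK₀-residue ρ∈
    ... | ρ<M , val = fromℕ< (<M⇒<N ρ<M) ,
      ∈-filter⁺ _ (∈-allFin _) (valK₀⇒stab≡gen _ (subst ValK₀ (sym (toℕ-fromℕ< (<M⇒<N ρ<M))) val)) ,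
      cong (orbit N d r) (toℕ-fromℕ< (<M⇒<N ρ<M))

    numOrbitsWithStab≡ : numOrbitsWithStab N d r (gen N (p ^ m)) ≡ p ^ v * (p ∸ 1)
    numOrbitsWithStab≡ = begin
      numOrbitsWithStab N d r (gen N (p ^ m))
        ≡⟨ length-deduplicate-map {P = ValK₀Residue} (orbit N d r) residue-injective
             (≡-dec Bool._≟_) (λ j → orbit N d r (toℕ j)) stabilisers
             (filter⁺ valK₀? (upTo⁺ M)) (All.tabulate valK₀-residue) stabiliser→residue residue→stabiliser ⟩
      count valK₀? M
        ≡⟨ count-valK₀ ⟩
      p ^ v * (p ∸ 1) ∎
      where open ≡-Reasoning

lemma4p8 : (p n d r m v : ℕ) → Prime p → p ≢ 2 → 1 ≤ n
    → d < p ^ n → Coprime d (p ^ n) → MulOrder (p ^ n) d (p ^ (n ∸ 1))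
    → 0 < r → r ≤ p ^ (n ∸ 1) → IsValuation p r v
    → 0 < m → m ≤ n ∸ 1 ∸ v
    → numOrbitsWithStab (p ^ n) d r (gen (p ^ n) (p ^ m)) ≡ p ^ v * (p ∸ 1)
lemma4p8 p (suc n₁) d r m v p-prime _ _ _ _ ord _ _ r-val 0<m m≤n₁∸v =
  Action.Stabiliser.numOrbitsWithStab≡ p-prime n₁ d r v ord r-val m 0<m m≤n₁∸v
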